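{- Let $k\ge 3$ be an integer and $n=2^k$. If $2^k-1$ is prime, then for every integer $m\ge 1$ the cycle chain $\mathcal{C}_n^m$ has a prime vertex labeling.
   Context: All graphs are simple and connected. A graph with $N$ vertices has a prime vertex labeling if its vertices can be labeled bijectively with $1,2,\ldots,N$ so that adjacent vertices receive relatively prime labels. For even $n\ge 4$ and $m\ge 1$, the cycle chain $\mathcal{C}_n^m$ consists of $m$ copies $C^{(1)},\ldots,C^{(m)}$ of the $n$-cycle such that consecutive cycles $C^{(i)}$ and $C^{(i+1)}$ share exactly one common vertex, non-consecutive cycles share no vertex, and in each cycle $C^{(i)}$ with $1<i<m$ the two shared vertices (the one shared with $C^{(i-1)}$ and the one shared with $C^{(i+1)}$) are at distance $n/2$ in that cycle, i.e. they split it into two paths of equal length $n/2$. It has $m(n-1)+1$ vertices. -}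

module Defs where

open import Data.Nat using (ℕ; zero; suc; _+_; _*_; _∸_; _<_; _/_)
open import Data.Nat.Coprimality using (Coprime)
open import Data.Fin using (Fin; toℕ)
open import Data.List using (List; []; _∷_; _++_; upTo; map)
open import Data.List.Membership.Propositional using (_∈_)
open import Data.Product using (_×_; _,_; ∃; ∃-syntax)
open import Function.Definitions using (Bijective)
open import Relation.Binary.PropositionalEquality using (_≡_)

pathEdges : List ℕ → List (ℕ × ℕ)
pathEdges []            = []
pathEdges (x ∷ [])      = []
pathEdges (x ∷ y ∷ xs)  = (x , y) ∷ pathEdges (y ∷ xs)

-- One n-cycle (n even) on the offsets 0 .. n-1, where the offsets 0 and n-1
-- are the two "shared" vertices, at distance n/2 from each other:
--   upper path : 0, 1, 2, ..., n/2 - 1, n-1          (length n/2)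
--   lower path : 0, n/2, n/2 + 1, ..., n-2, n-1      (length n/2)
cycleOffsetEdges : ℕ → List (ℕ × ℕ)
cycleOffsetEdges n =
  pathEdges (upTo (n / 2) ++ (n ∸ 1 ∷ []))
  ++ pathEdges (0 ∷ map (λ j → n / 2 + j) (upTo (n / 2 ∸ 1)) ++ (n ∸ 1 ∷ []))

-- Cycle chain C_n^m on the vertex set {0, …, m(n-1)}: the i-th cycle
-- (i = 0 … m-1) is the cycle above shifted by i(n-1); so cycle i and cycle i+1
-- share exactly the vertex (i+1)(n-1), and in every cycle the two shared
-- vertices split it into two paths of length n/2.
numVertices : ℕ → ℕ → ℕ
numVertices n m = m * (n ∸ 1) + 1

ChainEdge : (n m : ℕ) → ℕ → ℕ → Set
ChainEdge n m u v =
  ∃[ i ] ∃[ a ] ∃[ c ]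
    (i < m × (a , c) ∈ cycleOffsetEdges n
     × u ≡ i * (n ∸ 1) + a × v ≡ i * (n ∸ 1) + c)

-- A prime vertex labeling of a graph on vertex set Fin N with adjacency Adj:
-- a bijection σ of Fin N, vertex v gets label 1 + σ v ∈ {1,…,N}, and adjacent
-- vertices get coprime labels.
PrimeLabeling : (N : ℕ) → (ℕ → ℕ → Set) → Set
PrimeLabeling N Adj =
  ∃[ σ ] (Bijective {A = Fin N} {B = Fin N} _≡_ _≡_ σ
          × (∀ (u v : Fin N) → Adj (toℕ u) (toℕ v) →
               Coprime (suc (toℕ (σ u))) (suc (toℕ (σ v)))))

CycleChainHasPrimeLabeling : ℕ → ℕ → Set
CycleChainHasPrimeLabeling n m = PrimeLabeling (numVertices n m) (ChainEdge n m)

-- Write n = 2h with h = 1 + h1, and p = n - 1 = h + h1.  The chain has the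
-- vertices 0, …, mp; cycle i consists of the vertices ip + a for the offsets
-- 0 ≤ a ≤ p, its upper path being the offsets 0, 1, …, h1, p and its lower path
-- the offsets 0, h, h + 1, …, p.  Vertex v receives the label 1 + σ v, where σ
-- is the involution of {0, …, mp} that
--   * reverses the offsets 0, …, h1 of every odd-numbered cycle, and
--   * when m is odd, reverses the interval from (m-1)p + h to mp (the lower
--     path of the final cycle together with the last vertex),
-- and fixes every other vertex.  Along every edge the two labels are then
-- consecutive, or of the form x, x + p with x ≡ 1 or x ≡ h (mod p), or of the
-- form x, x + h with x odd.  All of these are coprime pairs as soon as h is
-- coprime to every odd number, i.e. as soon as h is a power of two.
module Submission where

open import Data.Bool using (Bool; true; false; not; T)
open import Data.Bool.Properties using (not-involutive)
open import Data.Empty using (⊥-elim)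
open import Data.Fin using (Fin; toℕ; fromℕ<)
open import Data.Fin.Properties using (toℕ<n; toℕ-fromℕ<; toℕ-injective)
open import Data.List using (List; _∷_; []; _++_; applyUpTo; upTo; map)
open import Data.List.Properties using (map-upTo)
open import Data.List.Membership.Propositional using (_∈_)
open import Data.List.Membership.Propositional.Properties using (∈-++⁻)
open import Data.List.Relation.Unary.Any using (here; there)
open import Data.Maybe using (Maybe; just; nothing)
open import Data.Nat
open import Data.Nat.Properties
open import Data.Nat.DivMod
open import Data.Nat.Divisibility using (_∣_; ∣-trans; ∣m+n∣m⇒∣n; n∣m*n)
open import Data.Nat.Coprimality as Coprimality using (Coprime; coprime-+; 1-coprimeTo; coprime-divisor)
open import Data.Nat.Primality using (Prime)
open import Data.Nat.Tactic.RingSolver using (solve-∀)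
open import Data.Product using (_×_; _,_; proj₁; ∃-syntax)
open import Data.Sum using (_⊎_; inj₁; inj₂)
open import Data.Unit using (tt)
open import Function using (_∘_)
open import Relation.Nullary using (¬_; Dec; yes; no)
open import Relation.Nullary.Decidable using (_×-dec_; T?)
open import Relation.Binary.PropositionalEquality
open import Defs

odd : ℕ → Bool
odd zero    = false
odd (suc n) = not (odd n)

Odd : ℕ → Set
Odd n = T (odd n)

odd⇒even-suc : ∀ n → Odd n → ¬ Odd (suc n)
odd⇒even-suc n o with odd n
... | true = λ ()

even⇒odd-suc : ∀ n → ¬ Odd n → Odd (suc n)
even⇒odd-suc n ¬o with odd n
... | false = tt
... | true  = ¬o tt

odd⇒suc-pred : ∀ n → Odd n → suc (pred n) ≡ n
odd⇒suc-pred (suc n) _ = refl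

even⇒double : ∀ n → ¬ Odd n → ∃[ t ] n ≡ t + t
even⇒double zero          _  = 0 , refl
even⇒double (suc zero)    ¬o = ⊥-elim (¬o tt)
even⇒double (suc (suc n)) ¬o
  with t , n≡2t ← even⇒double n (subst (λ b → ¬ T b) (not-involutive (odd n)) ¬o)
  = suc t , cong suc (trans (cong suc n≡2t) (sym (+-suc t t)))

coprime-suc : ∀ n → Coprime n (suc n)
coprime-suc n = Coprimality.sym (subst (λ k → Coprime k n) (+-comm n 1) (coprime-+ (1-coprimeTo n)))

coprime-+ʳ : ∀ {a d} → Coprime a d → Coprime a (a + d)
coprime-+ʳ c = Coprimality.sym (coprime-+ (Coprimality.sym c))

coprime-+-multiple : ∀ q {p x} → Coprime x p → Coprime (x + q * p) p
coprime-+-multiple q {p} {x} x⊥p {d} (d∣x+qp , d∣p) =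
  x⊥p (∣m+n∣m⇒∣n (subst (d ∣_) (+-comm x (q * p)) d∣x+qp) (∣-trans d∣p (n∣m*n q)) , d∣p)

coprime-≡ : ∀ {a a′ b b′} → a ≡ a′ → b ≡ b′ → Coprime a′ b′ → Coprime a b
coprime-≡ refl refl c = c

consecutive : ∀ {a b} → b ≡ suc a → Coprime a b
consecutive refl = coprime-suc _

consecutive′ : ∀ {a b} → a ≡ suc b → Coprime a b
consecutive′ refl = Coprimality.sym (coprime-suc _)

coprime-* : ∀ {a b c} → Coprime a b → Coprime a c → Coprime a (b * c)
coprime-* a⊥b a⊥c (d∣a , d∣bc) =
  a⊥c (d∣a , coprime-divisor (λ (e∣d , e∣b) → a⊥b (∣-trans e∣d d∣a , e∣b)) d∣bc)

coprime-^ : ∀ {a b} → Coprime a b → ∀ j → Coprime a (b ^ j)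
coprime-^ {a} a⊥b zero    = Coprimality.sym (1-coprimeTo a)
coprime-^     a⊥b (suc j) = coprime-* a⊥b (coprime-^ a⊥b j)

odd-coprime-2^ : ∀ t j → Coprime (suc (t + t)) (2 ^ j)
odd-coprime-2^ t = coprime-^ (subst (λ x → Coprime x 2) 1+t*2≡odd (coprime-+-multiple t (1-coprimeTo 2)))
  where
  1+t*2≡odd : 1 + t * 2 ≡ suc (t + t)
  1+t*2≡odd = cong suc (trans (*-comm t 2) (cong (t +_) (+-identityʳ t)))

involution⇒prime-labeling : ∀ N (Adj : ℕ → ℕ → Set) (σ : ℕ → ℕ) →
  (∀ {v} → v < N → σ v < N) → (∀ {v} → v < N → σ (σ v) ≡ v) →
  (∀ {u v} → Adj u v → Coprime (suc (σ u)) (suc (σ v))) →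
  PrimeLabeling N Adj
involution⇒prime-labeling N Adj σ σ-bounded σ-involutive σ-coprime =
  σᶠ , (injective , surjective) , λ u v adj →
    subst₂ (λ x y → Coprime (suc x) (suc y)) (sym (toℕ-σᶠ u)) (sym (toℕ-σᶠ v)) (σ-coprime adj)
  where
  σᶠ : Fin N → Fin N
  σᶠ u = fromℕ< (σ-bounded (toℕ<n u))

  toℕ-σᶠ : ∀ u → toℕ (σᶠ u) ≡ σ (toℕ u)
  toℕ-σᶠ u = toℕ-fromℕ< _

  σᶠ-involutive : ∀ u → σᶠ (σᶠ u) ≡ u
  σᶠ-involutive u = toℕ-injective (begin
    toℕ (σᶠ (σᶠ u))  ≡⟨ toℕ-σᶠ (σᶠ u) ⟩
    σ (toℕ (σᶠ u))   ≡⟨ cong σ (toℕ-σᶠ u) ⟩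
    σ (σ (toℕ u))    ≡⟨ σ-involutive (toℕ<n u) ⟩
    toℕ u            ∎)
    where open ≡-Reasoning

  injective : ∀ {u v} → σᶠ u ≡ σᶠ v → u ≡ v
  injective {u} {v} eq = trans (sym (σᶠ-involutive u)) (trans (cong σᶠ eq) (σᶠ-involutive v))

  surjective : ∀ v → ∃[ u ] (∀ {w} → w ≡ u → σᶠ w ≡ v)
  surjective v = σᶠ v , λ { refl → σᶠ-involutive v }

mirror-within : ∀ {lo hi v} → lo ≤ v → v ≤ hi → lo ≤ lo + hi ∸ v × lo + hi ∸ v ≤ hi
mirror-within {lo} {hi} {v} lo≤v v≤hi =
  subst (_≤ lo + hi ∸ v) (m+n∸n≡m lo hi) (∸-monoʳ-≤ (lo + hi) v≤hi) ,
  subst (lo + hi ∸ v ≤_) (m+n∸m≡n lo hi) (∸-monoʳ-≤ (lo + hi) lo≤v)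

mirror-shift : ∀ b {r c} → r ≤ c → b + (b + c) ∸ (b + r) ≡ b + (c ∸ r)
mirror-shift b {r} {c} r≤c = trans ([m+n]∸[m+o]≡n∸o b (b + c) r) (+-∸-assoc b r≤c)

∸-step : ∀ {m n} → n < m → m ∸ n ≡ suc (m ∸ suc n)
∸-step {suc m} {zero}  _         = refl
∸-step {suc m} {suc n} (s<s n<m) = ∸-step n<m

-- A map that reverses each interval [lo, hi] of a family of disjoint intervals
-- and fixes every other point; `segment v` is the interval containing v, if any.
module PiecewiseReversal (segment : ℕ → Maybe (ℕ × ℕ)) where

  reverse : ℕ → ℕ
  reverse v with segment v
  ... | nothing        = v
  ... | just (lo , hi) = lo + hi ∸ v

  reverse-outside : ∀ {v} → segment v ≡ nothing → reverse v ≡ v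
  reverse-outside {v} eq rewrite eq = refl

  reverse-inside : ∀ {v lo hi} → segment v ≡ just (lo , hi) → reverse v ≡ lo + hi ∸ v
  reverse-inside {v} eq rewrite eq = refl

  WellFormed : Set
  WellFormed = ∀ {v lo hi} → segment v ≡ just (lo , hi) →
    lo ≤ v × v ≤ hi × segment (lo + hi ∸ v) ≡ just (lo , hi)

  reverse-involutive : WellFormed → ∀ v → reverse (reverse v) ≡ v
  reverse-involutive wf v = by-segment (segment v) refl
    where
    open ≡-Reasoning
    by-segment : ∀ s → segment v ≡ s → reverse (reverse v) ≡ v
    by-segment nothing eq = trans (cong reverse (reverse-outside eq)) (reverse-outside eq)
    by-segment (just (lo , hi)) eq with _ , v≤hi , eq′ ← wf eq = begin
      reverse (reverse v)      ≡⟨ cong reverse (reverse-inside eq) ⟩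
      reverse (lo + hi ∸ v)    ≡⟨ reverse-inside eq′ ⟩
      lo + hi ∸ (lo + hi ∸ v)  ≡⟨ m∸[m∸n]≡n (≤-trans v≤hi (m≤n+m hi lo)) ⟩
      v                        ∎

  reverse-bounded : ∀ {N} → WellFormed → (∀ {v lo hi} → segment v ≡ just (lo , hi) → hi < N) →
    ∀ {v} → v < N → reverse v < N
  reverse-bounded {N} wf below {v} v<N = by-segment (segment v) refl
    where
    open ≤-Reasoning
    by-segment : ∀ s → segment v ≡ s → reverse v < N
    by-segment nothing eq = subst (_< N) (sym (reverse-outside eq)) v<N
    by-segment (just (lo , hi)) eq with lo≤v , _ , _ ← wf eq = begin-strict
      reverse v     ≡⟨ reverse-inside eq ⟩
      lo + hi ∸ v   ≤⟨ ∸-monoʳ-≤ (lo + hi) lo≤v ⟩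
      lo + hi ∸ lo  ≡⟨ m+n∸m≡n lo hi ⟩
      hi            <⟨ below eq ⟩
      N             ∎

data PathEdge (f : ℕ → ℕ) (l e : ℕ) : ℕ → ℕ → Set where
  step : ∀ {j} → j < l → PathEdge f l e (f j) (f (suc j))
  last : PathEdge f l e (f l) e

path-edge : ∀ f l e {a c} → (a , c) ∈ pathEdges (applyUpTo f (suc l) ++ e ∷ []) → PathEdge f l e a c
path-edge f zero    e (here refl) = last
path-edge f (suc l) e (here refl) = step z<s
path-edge f (suc l) e (there mem) with path-edge (f ∘ suc) l e mem
... | step j<l = step (s<s j<l)
... | last     = last

data CycleEdge (h1 : ℕ) : ℕ → ℕ → Set where
  upper       : ∀ {j} → j < h1 → CycleEdge h1 j (suc j)
  upper-end   : CycleEdge h1 h1 (suc h1 + h1)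
  lower-start : CycleEdge h1 0 (suc h1)
  lower       : ∀ {j} → j < h1 → CycleEdge h1 (suc h1 + j) (suc (suc h1 + j))

lowerVertex : ℕ → ℕ → ℕ
lowerVertex h1 zero    = 0
lowerVertex h1 (suc j) = suc h1 + j

lower-edge : ∀ h1 {a c} → PathEdge (lowerVertex h1) h1 (suc h1 + h1) a c → CycleEdge h1 a c
lower-edge h1       (step {zero} _)          = subst (CycleEdge h1 0) (sym (+-identityʳ (suc h1))) lower-start
lower-edge h1       (step {suc j} (s<s j<l)) =
  subst (CycleEdge h1 (suc h1 + j)) (sym (+-suc (suc h1) j)) (lower (m<n⇒m<1+n j<l))
lower-edge zero     last = lower-start
lower-edge (suc h2) last = subst (CycleEdge (suc h2) _) (sym (+-suc (2 + h2) h2)) (lower ≤-refl)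

cycleEdgeList : ℕ → ℕ → List (ℕ × ℕ)
cycleEdgeList h p = pathEdges (upTo h ++ p ∷ []) ++ pathEdges (0 ∷ map (h +_) (upTo (h ∸ 1)) ++ p ∷ [])

cycle-edge-shape′ : ∀ h1 {a c} → (a , c) ∈ cycleEdgeList (suc h1) (suc h1 + h1) → CycleEdge h1 a c
cycle-edge-shape′ h1 {a} {c} mem with ∈-++⁻ (pathEdges (upTo (suc h1) ++ suc h1 + h1 ∷ [])) mem
... | inj₁ mem-upper with path-edge (λ j → j) h1 (suc h1 + h1) mem-upper
...   | step j<h1 = upper j<h1
...   | last      = upper-end
cycle-edge-shape′ h1 {a} {c} mem | inj₂ mem-lower =
  lower-edge h1 (path-edge (lowerVertex h1) h1 (suc h1 + h1)
    (subst (λ L → (a , c) ∈ pathEdges (0 ∷ L ++ suc h1 + h1 ∷ [])) (map-upTo (suc h1 +_) h1) mem-lower))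

cycle-edge-shape : ∀ {n} h1 → n / 2 ≡ suc h1 → n ∸ 1 ≡ suc h1 + h1 →
  ∀ {a c} → (a , c) ∈ cycleOffsetEdges n → CycleEdge h1 a c
cycle-edge-shape h1 n/2≡h n∸1≡p {a} {c} =
  cycle-edge-shape′ h1 ∘ subst₂ (λ h p → (a , c) ∈ cycleEdgeList h p) n/2≡h n∸1≡p

-- The labelling of the chain C_n^m with n = 2h, h = 1 + h1 ≥ 2.  Vertex
-- q p + r (0 ≤ r < p) is offset r of cycle q; the shared vertex (q + 1) p is
-- offset p of cycle q and offset 0 of cycle q + 1.
module ChainLabelling (h1 : ℕ) .{{_ : NonZero h1}} (m : ℕ) where

  h p : ℕ
  h = suc h1
  p = h + h1

  h<p : h < p
  h<p = subst (_< p) (+-identityʳ h) (+-monoʳ-< h (>-nonZero⁻¹ h1))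

  block-div : ∀ q {r} → r < p → (q * p + r) / p ≡ q
  block-div q {r} r<p = begin
    (q * p + r) / p      ≡⟨ +-distrib-/-∣ˡ r (n∣m*n q) ⟩
    q * p / p + r / p    ≡⟨ cong₂ _+_ (m*n/n≡m q p) (m<n⇒m/n≡0 r<p) ⟩
    q + 0                ≡⟨ +-identityʳ q ⟩
    q                    ∎
    where open ≡-Reasoning

  block-mod : ∀ q {r} → r < p → (q * p + r) % p ≡ r
  block-mod q r<p = trans (%-remove-+ˡ _ (n∣m*n q)) (m<n⇒m%n≡m r<p)

  block-decomposition : ∀ v → v ≡ v / p * p + v % p
  block-decomposition v = trans (m≡m%n+[m/n]*n v p) (+-comm (v % p) _)

  top finalStart : ℕ
  top = m * p
  finalStart = pred m * p + h

  InFinal : ℕ → Set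
  InFinal v = Odd m × finalStart ≤ v × v ≤ top

  InHead : ℕ → ℕ → Set
  InHead q r = Odd q × q < m × r < h

  inFinal? : ∀ v → Dec (InFinal v)
  inFinal? v = T? (odd m) ×-dec (finalStart ≤? v ×-dec v ≤? top)

  inHead? : ∀ q r → Dec (InHead q r)
  inHead? q r = T? (odd q) ×-dec (q <? m ×-dec r <? h)

  segment : ℕ → Maybe (ℕ × ℕ)
  segment v with inFinal? v | inHead? (v / p) (v % p)
  ... | yes _ | _     = just (finalStart , top)
  ... | no _  | yes _ = just (v / p * p , v / p * p + h1)
  ... | no _  | no _  = nothing

  segment-final : ∀ {v} → InFinal v → segment v ≡ just (finalStart , top)
  segment-final {v} F with inFinal? v
  ... | yes _ = refl
  ... | no ¬F = ⊥-elim (¬F F)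

  segment-head-case : ∀ {v} → ¬ InFinal v → InHead (v / p) (v % p) →
    segment v ≡ just (v / p * p , v / p * p + h1)
  segment-head-case {v} ¬F H with inFinal? v | inHead? (v / p) (v % p)
  ... | yes F | _     = ⊥-elim (¬F F)
  ... | no _  | yes _ = refl
  ... | no _  | no ¬H = ⊥-elim (¬H H)

  segment-none-case : ∀ {v} → ¬ InFinal v → ¬ InHead (v / p) (v % p) → segment v ≡ nothing
  segment-none-case {v} ¬F ¬H with inFinal? v | inHead? (v / p) (v % p)
  ... | yes F | _     = ⊥-elim (¬F F)
  ... | no _  | yes H = ⊥-elim (¬H H)
  ... | no _  | no _  = refl

  -- Heads lie strictly before the final segment, so they are disjoint from it.
  head-not-final : ∀ {q r} → InHead q r → ¬ InFinal (q * p + r)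
  head-not-final {q} {r} (_ , q<m , r<h) (_ , start≤v , _) =
    <⇒≱ (+-mono-≤-< (*-monoˡ-≤ p (<⇒≤pred q<m)) r<h) start≤v

  segment-head : ∀ {q r} → InHead q r → segment (q * p + r) ≡ just (q * p , q * p + h1)
  segment-head {q} {r} H@(_ , _ , r<h) =
    subst (λ x → segment (q * p + r) ≡ just (x * p , x * p + h1)) (block-div q r<p)
      (segment-head-case (head-not-final H)
        (subst₂ InHead (sym (block-div q r<p)) (sym (block-mod q r<p)) H))
    where r<p = <-trans r<h h<p

  head-mirror : ∀ {q r} → InHead q r →
    q * p ≤ q * p + r × q * p + r ≤ q * p + h1 ×
    segment (q * p + (q * p + h1) ∸ (q * p + r)) ≡ just (q * p , q * p + h1)
  head-mirror {q} {r} (oq , q<m , r<h) =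
    m≤m+n (q * p) r , +-monoʳ-≤ (q * p) r≤h1 ,
    trans (cong segment (mirror-shift (q * p) r≤h1)) (segment-head (oq , q<m , s≤s (m∸n≤m h1 r)))
    where r≤h1 = s≤s⁻¹ r<h

  open PiecewiseReversal segment using () renaming (reverse to σ) public
  open PiecewiseReversal segment
    using (WellFormed; reverse-inside; reverse-outside; reverse-involutive; reverse-bounded)

  segment-wf : WellFormed
  segment-wf {v} eq with inFinal? v | inHead? (v / p) (v % p)
  segment-wf {v} refl | yes (om , start≤v , v≤top) | _ =
    start≤v , v≤top , segment-final (om , mirror-within start≤v v≤top)
  segment-wf {v} refl | no _ | yes H =
    subst (λ x → v / p * p ≤ x × x ≤ v / p * p + h1 ×
                 segment (v / p * p + (v / p * p + h1) ∸ x) ≡ just (v / p * p , v / p * p + h1))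
          (sym (block-decomposition v)) (head-mirror H)

  segment-below : ∀ {v lo hi} → segment v ≡ just (lo , hi) → hi < suc top
  segment-below {v} eq with inFinal? v | inHead? (v / p) (v % p)
  segment-below {v} refl | yes _ | _ = ≤-refl
  segment-below {v} refl | no _ | yes (_ , q<m , _) = s≤s (begin
    v / p * p + h1  ≤⟨ +-monoʳ-≤ (v / p * p) (m≤n+m h1 h) ⟩
    v / p * p + p   ≡⟨ +-comm (v / p * p) p ⟩
    suc (v / p) * p ≤⟨ *-monoˡ-≤ p q<m ⟩
    top             ∎)
    where open ≤-Reasoning

  σ-involutive : ∀ v → σ (σ v) ≡ v
  σ-involutive = reverse-involutive segment-wf

  σ-bounded : ∀ {v} → v < suc top → σ v < suc top
  σ-bounded = reverse-bounded segment-wf segment-below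

  σ-final : ∀ {v} → InFinal v → σ v ≡ finalStart + top ∸ v
  σ-final F = reverse-inside (segment-final F)

  σ-head : ∀ q {r} → InHead q r → σ (q * p + r) ≡ q * p + (h1 ∸ r)
  σ-head q H@(_ , _ , r<h) = trans (reverse-inside (segment-head H)) (mirror-shift (q * p) (s≤s⁻¹ r<h))

  σ-fixed : ∀ q {r} → r < p → ¬ InFinal (q * p + r) → ¬ InHead q r → σ (q * p + r) ≡ q * p + r
  σ-fixed q {r} r<p ¬F ¬H = reverse-outside (segment-none-case ¬F
    (subst₂ (λ a b → ¬ InHead a b) (sym (block-div q r<p)) (sym (block-mod q r<p)) ¬H))

  final-position : ∀ {q r} → r < p → InFinal (q * p + r) → q ≡ m ⊎ (suc q ≡ m × h ≤ r)
  final-position {q} {r} r<p (om , start≤v , v≤top)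
    with m≤n⇒m<n∨m≡n (*-cancelʳ-≤ q m p (≤-trans (m≤m+n (q * p) r) v≤top))
  ... | inj₂ q≡m = inj₁ q≡m
  ... | inj₁ q<m = inj₂ (trans (cong suc q≡k) 1+k≡m ,
                         +-cancelˡ-≤ (q * p) h r (subst (λ x → x * p + h ≤ q * p + r) (sym q≡k) start≤v))
    where
    k = pred m
    1+k≡m : suc k ≡ m
    1+k≡m = odd⇒suc-pred m om
    k<1+q : k < suc q
    k<1+q = *-cancelʳ-< p k (suc q) (begin-strict
      k * p          ≤⟨ m≤m+n (k * p) h ⟩
      finalStart     ≤⟨ start≤v ⟩
      q * p + r      <⟨ +-monoʳ-< (q * p) r<p ⟩
      q * p + p      ≡⟨ +-comm (q * p) p ⟩
      suc q * p      ∎)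
      where open ≤-Reasoning
    q≡k : q ≡ k
    q≡k = ≤-antisym (s≤s⁻¹ (subst (suc q ≤_) (sym 1+k≡m) q<m)) (s≤s⁻¹ k<1+q)

  not-final : ∀ {q r} → r < p → (Odd m → q ≢ m) → (Odd m → suc q ≡ m → ¬ h ≤ r) →
    ¬ InFinal (q * p + r)
  not-final r<p ¬top ¬final F@(om , _) with final-position r<p F
  ... | inj₁ q≡m           = ¬top om q≡m
  ... | inj₂ (1+q≡m , h≤r) = ¬final om 1+q≡m h≤r

  next-block : ∀ i → i * p + p ≡ suc i * p + 0
  next-block i = trans (+-comm (i * p) p) (sym (+-identityʳ (suc i * p)))

  odd-not-final : ∀ i → Odd i → Odd m → suc i ≢ m
  odd-not-final i oi om 1+i≡m = odd⇒even-suc i oi (subst Odd (sym 1+i≡m) om)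

  -- σ on an even cycle i that is not the final one: everything is fixed except
  -- the shared vertex p, which is the start of the head of the odd cycle i + 1.
  even-fixed : ∀ i {a} → ¬ Odd i → suc i < m → a < p → σ (i * p + a) ≡ i * p + a
  even-fixed i ev 1+i<m a<p =
    σ-fixed i a<p (not-final a<p (λ _ → i≢m) (λ _ 1+i≡m _ → <-irrefl 1+i≡m 1+i<m)) (ev ∘ proj₁)
    where
    i≢m : i ≢ m
    i≢m i≡m = <⇒≱ 1+i<m (subst (_≤ suc i) i≡m (n≤1+n i))

  even-end : ∀ i → ¬ Odd i → suc i < m → σ (i * p + p) ≡ i * p + p + h1
  even-end i ev 1+i<m = begin
    σ (i * p + p)         ≡⟨ cong σ (next-block i) ⟩
    σ (suc i * p + 0)     ≡⟨ σ-head (suc i) (even⇒odd-suc i ev , 1+i<m , z<s) ⟩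
    p + i * p + h1        ≡⟨ cong (_+ h1) (+-comm p (i * p)) ⟩
    i * p + p + h1        ∎
    where open ≡-Reasoning

  odd-head : ∀ i {a} → Odd i → i < m → a < h → σ (i * p + a) ≡ i * p + (h1 ∸ a)
  odd-head i oi i<m a<h = σ-head i (oi , i<m , a<h)

  odd-lower : ∀ i {a} → Odd i → i < m → h ≤ a → a ≤ p → σ (i * p + a) ≡ i * p + a
  odd-lower i {a} oi i<m h≤a a≤p with m≤n⇒m<n∨m≡n a≤p
  ... | inj₁ a<p = σ-fixed i a<p (not-final a<p (λ _ → <⇒≢ i<m) (λ om 1+i≡m _ → odd-not-final i oi om 1+i≡m))
                               (λ (_ , _ , a<h) → <⇒≱ a<h h≤a)
  ... | inj₂ refl = begin
    σ (i * p + p)         ≡⟨ cong σ (next-block i) ⟩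
    σ (suc i * p + 0)     ≡⟨ σ-fixed (suc i) z<s (not-final z<s (odd-not-final i oi) (λ _ _ h≤0 → <⇒≱ z<s h≤0))
                                     (odd⇒even-suc i oi ∘ proj₁) ⟩
    suc i * p + 0         ≡⟨ sym (next-block i) ⟩
    i * p + p             ∎
    where open ≡-Reasoning

  final-upper : ∀ i {a} → ¬ Odd i → suc i ≡ m → a < h → σ (i * p + a) ≡ i * p + a
  final-upper i ev 1+i≡m a<h = σ-fixed i a<p (not-final a<p (λ _ → i≢m) (λ _ _ → <⇒≱ a<h)) (ev ∘ proj₁)
    where
    a<p = <-trans a<h h<p
    i≢m : i ≢ m
    i≢m i≡m = 1+n≢n (trans 1+i≡m (sym i≡m))

  final-lower : ∀ i {a} → ¬ Odd i → suc i ≡ m → h ≤ a → a ≤ p → σ (i * p + a) ≡ i * p + (p + h ∸ a)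
  final-lower i {a} ev 1+i≡m h≤a a≤p = begin
    σ (X + a)                      ≡⟨ σ-final (subst Odd 1+i≡m (even⇒odd-suc i ev) , start≤ , ≤top) ⟩
    finalStart + top ∸ (X + a)     ≡⟨ cong₂ (λ s t → s + t ∸ (X + a)) start≡ top≡ ⟩
    (X + h) + (p + X) ∸ (X + a)    ≡⟨ cong (_∸ (X + a)) (rearrange X p h) ⟩
    X + (X + (p + h)) ∸ (X + a)    ≡⟨ mirror-shift X (≤-trans a≤p (m≤m+n p h)) ⟩
    X + (p + h ∸ a)                ∎
    where
    open ≡-Reasoning
    X = i * p
    start≡ : finalStart ≡ X + h
    start≡ = cong (λ k → k * p + h) (cong pred (sym 1+i≡m))
    top≡ : top ≡ p + X
    top≡ = cong (_* p) (sym 1+i≡m)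
    start≤ : finalStart ≤ X + a
    start≤ = subst (_≤ X + a) (sym start≡) (+-monoʳ-≤ X h≤a)
    ≤top : X + a ≤ top
    ≤top = subst (X + a ≤_) (trans (+-comm X p) (sym top≡)) (+-monoʳ-≤ X a≤p)
    rearrange : ∀ x y z → (x + z) + (y + x) ≡ x + (x + (y + z))
    rearrange = solve-∀

  label : ℕ → ℕ → ℕ
  label i a = suc (σ (i * p + a))

  -- Labels x and x + p are coprime when x is coprime to p; this is used for
  -- x = 1 + i p and for x = h + i p, as h and p = h + h1 are coprime.
  coprime-shift-by-p : ∀ {x} → Coprime x p → ∀ i → Coprime (x + i * p) (x + i * p + p)
  coprime-shift-by-p x⊥p i = coprime-+ʳ (coprime-+-multiple i x⊥p)

  h⊥p : Coprime h p
  h⊥p = coprime-+ʳ (Coprimality.sym (coprime-suc h1))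

  j<p : ∀ {j} → j < h1 → j < p
  j<p j<h1 = <-trans (m<n⇒m<1+n j<h1) h<p

  h+j<p : ∀ {j} → j < h1 → suc (h + j) ≤ p
  h+j<p {j} j<h1 = subst (_≤ p) (+-suc h j) (+-monoʳ-≤ h j<h1)

  -- On an odd cycle the labels along the edges are consecutive, except on
  -- the edge (h1, p), where they are 1 + i p and 1 + i p + p.
  odd-cycle-coprime : ∀ i → Odd i → i < m → ∀ {a c} → CycleEdge h1 a c → Coprime (label i a) (label i c)
  odd-cycle-coprime i oi i<m (upper {j} j<h1)
    rewrite odd-head i oi i<m (m<n⇒m<1+n j<h1) | odd-head i oi i<m (s<s j<h1)
    = consecutive′ (cong suc (trans (cong (i * p +_) (∸-step j<h1)) (+-suc (i * p) _)))
  odd-cycle-coprime i oi i<m upper-end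
    rewrite odd-head i oi i<m ≤-refl | n∸n≡0 h1 | +-identityʳ (i * p) | odd-lower i oi i<m (<⇒≤ h<p) ≤-refl
    = coprime-shift-by-p (1-coprimeTo p) i
  odd-cycle-coprime i oi i<m lower-start
    rewrite odd-head i oi i<m z<s | odd-lower i oi i<m ≤-refl (<⇒≤ h<p)
    = consecutive (cong suc (+-suc (i * p) h1))
  odd-cycle-coprime i oi i<m (lower {j} j<h1)
    rewrite odd-lower i oi i<m (m≤m+n h j) (<⇒≤ (h+j<p j<h1))
          | odd-lower i oi i<m (m≤n⇒m≤1+n (m≤m+n h j)) (h+j<p j<h1)
    = consecutive (cong suc (+-suc (i * p) (h + j)))

  -- On the final cycle of an odd chain the labels along the edges are
  -- consecutive, except on the edge (0, h), where they are 1 + i p and 1 + i p + p.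
  final-cycle-coprime : ∀ i → ¬ Odd i → suc i ≡ m → ∀ {a c} → CycleEdge h1 a c → Coprime (label i a) (label i c)
  final-cycle-coprime i ev 1+i≡m (upper {j} j<h1)
    rewrite final-upper i ev 1+i≡m (m<n⇒m<1+n j<h1) | final-upper i ev 1+i≡m (s<s j<h1)
    = consecutive (cong suc (+-suc (i * p) j))
  final-cycle-coprime i ev 1+i≡m upper-end
    rewrite final-upper i ev 1+i≡m ≤-refl | final-lower i ev 1+i≡m (<⇒≤ h<p) ≤-refl | m+n∸m≡n p h
    = consecutive (cong suc (+-suc (i * p) h1))
  final-cycle-coprime i ev 1+i≡m lower-start
    rewrite final-upper i ev 1+i≡m z<s | final-lower i ev 1+i≡m ≤-refl (<⇒≤ h<p) | m+n∸n≡m p h | +-identityʳ (i * p)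
    = coprime-shift-by-p (1-coprimeTo p) i
  final-cycle-coprime i ev 1+i≡m (lower {j} j<h1)
    rewrite final-lower i ev 1+i≡m (m≤m+n h j) (<⇒≤ (h+j<p j<h1))
          | final-lower i ev 1+i≡m (m≤n⇒m≤1+n (m≤m+n h j)) (h+j<p j<h1)
    = consecutive′ (cong suc (trans (cong (i * p +_) (∸-step (≤-trans (h+j<p j<h1) (m≤m+n p h)))) (+-suc (i * p) _)))

  even-base : ∀ i → ¬ Odd i → ∃[ t ] i * p ≡ t + t
  even-base i ev with t , i≡2t ← even⇒double i ev = t * p , trans (cong (_* p) i≡2t) (*-distribʳ-+ p t t)

  -- On any other even cycle the labels along the edges are consecutive,
  -- except h + i p and h + i p + p on (h1, p), and the pairs x, x + h with
  -- x = 1 + i p resp. x = i p + p odd on (0, h) resp. (p - 1, p).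
  even-cycle-coprime : (∀ t → Coprime (suc (t + t)) h) →
    ∀ i → ¬ Odd i → suc i < m → ∀ {a c} → CycleEdge h1 a c → Coprime (label i a) (label i c)
  even-cycle-coprime odd⊥h i ev 1+i<m (upper {j} j<h1)
    rewrite even-fixed i ev 1+i<m (j<p j<h1) | even-fixed i ev 1+i<m (<-≤-trans (s<s j<h1) (<⇒≤ h<p))
    = consecutive (cong suc (+-suc (i * p) j))
  even-cycle-coprime odd⊥h i ev 1+i<m upper-end
    rewrite even-fixed i ev 1+i<m (<-trans ≤-refl h<p) | even-end i ev 1+i<m
    = coprime-≡ (trans (sym (+-suc (i * p) h1)) (+-comm (i * p) h)) (rearrange (i * p) p h1) (coprime-shift-by-p h⊥p i)
    where
    rearrange : ∀ x y z → suc (x + y + z) ≡ suc z + x + y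
    rearrange = solve-∀
  even-cycle-coprime odd⊥h i ev 1+i<m lower-start
    rewrite even-fixed i ev 1+i<m z<s | even-fixed i ev 1+i<m h<p | +-identityʳ (i * p)
    with t , X≡2t ← even-base i ev
    = coprime-≡ (cong suc X≡2t) (cong (λ x → suc x + h) X≡2t) (coprime-+ʳ (odd⊥h t))
  even-cycle-coprime odd⊥h i ev 1+i<m (lower {j} j<h1) with m≤n⇒m<n∨m≡n (h+j<p j<h1)
  ... | inj₁ 1+h+j<p
    rewrite even-fixed i ev 1+i<m (<-trans (n<1+n (h + j)) 1+h+j<p) | even-fixed i ev 1+i<m 1+h+j<p
    = consecutive (cong suc (+-suc (i * p) (h + j)))
  ... | inj₂ 1+h+j≡p
    rewrite even-fixed i ev 1+i<m (h+j<p j<h1) | 1+h+j≡p | even-end i ev 1+i<m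
    with t , X≡2t ← even-base i ev
    = coprime-≡ (trans (trans (sym (+-suc X (h + j))) (cong (X +_) 1+h+j≡p)) X+p≡odd)
                (trans (sym (+-suc (X + p) h1)) (cong (_+ h) X+p≡odd))
                (coprime-+ʳ (odd⊥h (t + h1)))
    where
    X = i * p
    X+p≡odd : X + p ≡ suc ((t + h1) + (t + h1))
    X+p≡odd = trans (cong (_+ p) X≡2t) (rearrange t h1)
      where
      rearrange : ∀ a b → (a + a) + (suc b + b) ≡ suc ((a + b) + (a + b))
      rearrange = solve-∀

  cycle-coprime : (∀ t → Coprime (suc (t + t)) h) →
    ∀ i → i < m → ∀ {a c} → CycleEdge h1 a c → Coprime (label i a) (label i c)
  cycle-coprime odd⊥h i i<m e with T? (odd i)
  ... | yes oi = odd-cycle-coprime i oi i<m e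
  ... | no ev with m≤n⇒m<n∨m≡n i<m
  ...   | inj₁ 1+i<m = even-cycle-coprime odd⊥h i ev 1+i<m e
  ...   | inj₂ 1+i≡m = final-cycle-coprime i ev 1+i≡m e

cycle-chain-prime-labeling : ∀ n h1 .{{_ : NonZero h1}} → n ≡ 2 * suc h1 →
  (∀ t → Coprime (suc (t + t)) (suc h1)) → ∀ m → CycleChainHasPrimeLabeling n m
cycle-chain-prime-labeling n h1 n≡2h odd⊥h m =
  subst (λ N → PrimeLabeling N (ChainEdge n m)) vertex-count
    (involution⇒prime-labeling (suc top) (ChainEdge n m) σ σ-bounded (λ {v} _ → σ-involutive v) edge-coprime)
  where
  open ChainLabelling h1 m
  n/2≡h : n / 2 ≡ h
  n/2≡h = trans (cong (_/ 2) (trans n≡2h (*-comm 2 h))) (m*n/n≡m h 2)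
  n∸1≡p : n ∸ 1 ≡ p
  n∸1≡p = trans (cong (_∸ 1) n≡2h) (trans (cong (h1 +_) (+-identityʳ h)) (+-comm h1 h))
  vertex-count : suc top ≡ numVertices n m
  vertex-count = trans (+-comm 1 top) (cong (λ x → m * x + 1) (sym n∸1≡p))
  edge-coprime : ∀ {u v} → ChainEdge n m u v → Coprime (suc (σ u)) (suc (σ v))
  edge-coprime (i , a , c , i<m , mem , refl , refl) =
    coprime-≡ (cong (λ x → suc (σ (i * x + a))) n∸1≡p) (cong (λ x → suc (σ (i * x + c))) n∸1≡p)
      (cycle-coprime odd⊥h i i<m (cycle-edge-shape {n} h1 n/2≡h n∸1≡p mem))

-- For n = 2^k take h = 2^(k-1), which is coprime to every odd number.
theorem5 : ∀ (k : ℕ) → 3 ≤ k → Prime (2 ^ k ∸ 1) →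
    ∀ (m : ℕ) → 1 ≤ m → CycleChainHasPrimeLabeling (2 ^ k) m
theorem5 (suc (suc (suc e))) (s≤s (s≤s (s≤s z≤n))) _ m _ =
  cycle-chain-prime-labeling (2 * H) h1 {{>-nonZero 0<h1}} (cong (2 *_) (sym 1+h1≡H)) odd⊥h m
  where
  H = 2 ^ suc (suc e)
  h1 = pred H
  1+h1≡H : suc h1 ≡ H
  1+h1≡H = suc-pred H {{m^n≢0 2 (suc (suc e))}}
  0<h1 : 0 < h1
  0<h1 = s≤s⁻¹ (subst (2 ≤_) (sym 1+h1≡H) (*-monoʳ-≤ 2 (m^n>0 2 (suc e))))
  odd⊥h : ∀ t → Coprime (suc (t + t)) (suc h1)
  odd⊥h t = subst (Coprime _) (sym 1+h1≡H) (odd-coprime-2^ t (suc (suc e)))
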